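{- The hyperpolygonal arrangement $\mathcal{H}_4$ in $\mathbb{R}^4$ is linearly isomorphic to the reflection arrangement $\mathcal{A}(D_4)=\{\ker(x_i-x_j),\ \ker(x_i+x_j)\mid 1\le i<j\le 4\}$ of the Weyl group of type $D_4$; that is, there is $\varphi\in\mathrm{GL}(\mathbb{R}^4)$ mapping the hyperplanes of $\mathcal{H}_4$ bijectively onto those of $\mathcal{A}(D_4)$.
   Context: Let $x_1,\dots,x_n$ be the coordinate functions on $\mathbb{R}^n$. For $I\subseteq[n]$ put $H_I:=\ker\big(\sum_{i\in I}x_i-\sum_{j\in[n]\setminus I}x_j\big)$, and $\mathcal{H}_n:=\{\ker x_i\mid i\in[n]\}\cup\{H_I\mid\varnothing\ne I\subseteq[n]\}$.
   Formalization: The arrangements $\mathcal{H}_4$ and $\mathcal{A}(D_4)$ are taken in ℚ^4 rather than $\mathbb{R}^4$, and the map φ is taken in GL(ℚ^4). -}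

module Defs where

open import Data.Nat using (ℕ; zero; suc)
open import Data.Fin using (Fin; zero; suc; _<_)
open import Data.Fin.Subset using (Subset; Nonempty; _∈_)
open import Data.Vec using (lookup)
open import Data.Bool using (Bool; true; false; if_then_else_)
open import Data.Rational using (ℚ; 0ℚ; 1ℚ; -_; _+_; _*_; _-_)
open import Data.Product using (Σ; ∃; _×_; _,_; proj₁; proj₂)
open import Data.Sum using (_⊎_; inj₁; inj₂)
open import Relation.Binary.PropositionalEquality using (_≡_)
open import Function.Bundles using (_⇔_)

Vecℚ : ℕ → Set
Vecℚ n = Fin n → ℚ

∑ : ∀ {n} → (Fin n → ℚ) → ℚ
∑ {zero}  f = 0ℚ
∑ {suc n} f = f zero + ∑ (λ i → f (suc i))

dot : ∀ {n} → Vecℚ n → Vecℚ n → ℚ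
dot f v = ∑ (λ i → f i * v i)

Mat : ℕ → Set
Mat n = Fin n → Fin n → ℚ

apply : ∀ {n} → Mat n → Vecℚ n → Vecℚ n
apply M v i = ∑ (λ j → M i j * v j)

mul : ∀ {n} → Mat n → Mat n → Mat n
mul M N i j = ∑ (λ k → M i k * N k j)

δ : ∀ {n} → Fin n → Fin n → ℚ
δ zero    zero    = 1ℚ
δ zero    (suc j) = 0ℚ
δ (suc i) zero    = 0ℚ
δ (suc i) (suc j) = δ i j

IsInverse : ∀ {n} → Mat n → Mat n → Set
IsInverse M N = (∀ i j → mul M N i j ≡ δ i j) × (∀ i j → mul N M i j ≡ δ i j)

Pred : ℕ → Set₁
Pred n = Vecℚ n → Set

Ker : ∀ {n} → Vecℚ n → Pred n
Ker f v = dot f v ≡ 0ℚ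

Image : ∀ {n} → Mat n → Pred n → Pred n
Image M P w = ∃ λ v → P v × (∀ i → apply M v i ≡ w i)

SameSet : ∀ {n} → Pred n → Pred n → Set
SameSet P Q = ∀ w → P w ⇔ Q w

coord : ∀ {n} → Fin n → Vecℚ n
coord i j = δ i j

hI : ∀ {n} → Subset n → Vecℚ n
hI I k = if lookup I k then 1ℚ else - 1ℚ

-- index set of the hyperpolygonal arrangement H_n:
-- ker x_i for i ∈ [n], and H_I for nonempty I ⊆ [n]
HIndex : ℕ → Set
HIndex n = Fin n ⊎ Σ (Subset n) Nonempty

hFun : ∀ {n} → HIndex n → Vecℚ n
hFun (inj₁ i)            = coord i
hFun (inj₂ (I , _)) = hI I

-- index set of A(D_n): pairs i<j and a sign (false: x_i − x_j, true: x_i + x_j)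
DIndex : ℕ → Set
DIndex n = Σ (Fin n × Fin n) (λ p → proj₁ p < proj₂ p) × Bool

dFun : ∀ {n} → DIndex n → Vecℚ n
dFun (((i , j) , _) , false) = λ k → coord i k - coord j k
dFun (((i , j) , _) , true)  = λ k → coord i k + coord j k

{-# OPTIONS --safe #-}
module Submission where

-- φ acts on each of the coordinate pairs (x₀, x₁) and (x₂, x₃) by the 2×2 Hadamard
-- matrix, scaled so that φ⁻¹ = 2φ.  The image of ker f under φ is ker (f ∘ φ⁻¹).
-- For a coordinate x_k this is ker (x_i ± x_j), {i, j} being the pair containing k.
-- For H_I with sign vector s, f ∘ φ⁻¹ = (s₀ + s₁, s₀ − s₁, s₂ + s₃, s₂ − s₃) has exactly
-- one nonzero entry in each pair, so it is a nonzero multiple of x_i ± x_j with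
-- i ∈ {0, 1}, j ∈ {2, 3}.  These 4 + 8 roots are the 12 hyperplanes of D₄.

open import Defs
open import Algebra.Bundles using (CommutativeRing)
open import Data.Bool using (Bool; true; false; not; _xor_)
open import Data.Fin using (Fin; zero; suc; _<_)
open import Data.Fin.Patterns using (0F; 1F; 2F; 3F)
open import Data.Fin.Properties using (all?)
open import Data.Fin.Subset using (Subset)
open import Data.Fin.Subset.Properties using (anySubset?)
open import Data.Nat using (zero; suc; z≤n; s≤s)
open import Data.Product using (Σ; ∃; _×_; _,_)
open import Data.Rational using (ℚ; 0ℚ; 1ℚ; ½; -½; -_; _+_; _*_; 1/_; ≢-nonZero)
open import Data.Rational.Properties
  using (_≟_; +-identityˡ; +-identityʳ; *-assoc; *-zeroˡ; *-zeroʳ; *-identityˡ; *-inverseˡ; +-*-commutativeRing)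
open import Data.Sum using (inj₁; inj₂)
open import Data.Vec using (Vec; _∷_; []; lookup; here)
open import Function.Base using (_∘_)
open import Function.Bundles using (mk⇔)
open import Function.Properties.Equivalence using () renaming (trans to ⇔-trans)
open import Relation.Binary.PropositionalEquality
  using (_≡_; _≢_; _≗_; refl; sym; trans; cong; module ≡-Reasoning)
open import Relation.Nullary.Decidable
  using (Dec; ¬?; _×-dec_; map′; decidable-stable; toWitness)
open import Relation.Unary using (Decidable)
import Algebra.Properties.Semiring.Sum (CommutativeRing.semiring +-*-commutativeRing) as Sum

open ≡-Reasoning

∑≡sum : ∀ {n} (f : Fin n → ℚ) → ∑ f ≡ Sum.sum f
∑≡sum {zero}  f = refl
∑≡sum {suc n} f = cong (f zero +_) (∑≡sum (f ∘ suc))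

∑-via-sum : ∀ {m n} (f : Fin m → ℚ) (g : Fin n → ℚ) → Sum.sum f ≡ Sum.sum g → ∑ f ≡ ∑ g
∑-via-sum f g eq = trans (∑≡sum f) (trans eq (sym (∑≡sum g)))

∑-cong : ∀ {n} {f g : Fin n → ℚ} → f ≗ g → ∑ f ≡ ∑ g
∑-cong {f = f} {g} f≗g = ∑-via-sum f g (Sum.sum-cong-≗ f≗g)

∑-zero : ∀ n → ∑ {n} (λ _ → 0ℚ) ≡ 0ℚ
∑-zero n = trans (∑≡sum {n} (λ _ → 0ℚ)) (Sum.sum-replicate-zero n)

*-distribˡ-∑ : ∀ {n} c (f : Fin n → ℚ) → c * ∑ f ≡ ∑ (λ i → c * f i)
*-distribˡ-∑ c f = trans (cong (c *_) (∑≡sum f)) (trans (Sum.*-distribˡ-sum c f) (sym (∑≡sum (λ i → c * f i))))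

*-distribʳ-∑ : ∀ {n} c (f : Fin n → ℚ) → ∑ f * c ≡ ∑ (λ i → f i * c)
*-distribʳ-∑ c f = trans (cong (_* c) (∑≡sum f)) (trans (Sum.*-distribʳ-sum c f) (sym (∑≡sum (λ i → f i * c))))

∑-comm : ∀ {m n} (F : Fin m → Fin n → ℚ) → ∑ (λ i → ∑ (F i)) ≡ ∑ (λ j → ∑ (λ i → F i j))
∑-comm F = begin
  ∑ (λ i → ∑ (F i))                ≡⟨ ∑-cong (∑≡sum ∘ F) ⟩
  ∑ (λ i → Sum.sum (F i))          ≡⟨ ∑-via-sum (λ i → Sum.sum (F i)) (λ j → Sum.sum (λ i → F i j)) (Sum.∑-comm F) ⟩
  ∑ (λ j → Sum.sum (λ i → F i j))  ≡⟨ ∑-cong (λ j → sym (∑≡sum (λ i → F i j))) ⟩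
  ∑ (λ j → ∑ (λ i → F i j))        ∎

infixl 7 _⊙_ _·_

_⊙_ : ∀ {n} → Vecℚ n → Mat n → Vecℚ n
(f ⊙ A) j = ∑ (λ i → f i * A i j)

_·_ : ∀ {n} → ℚ → Vecℚ n → Vecℚ n
(c · f) k = c * f k

dot-congˡ : ∀ {n} {f g : Vecℚ n} (v : Vecℚ n) → f ≗ g → dot f v ≡ dot g v
dot-congˡ v f≗g = ∑-cong (λ k → cong (_* v k) (f≗g k))

dot-congʳ : ∀ {n} (f : Vecℚ n) {v w : Vecℚ n} → v ≗ w → dot f v ≡ dot f w
dot-congʳ f v≗w = ∑-cong (λ k → cong (f k *_) (v≗w k))

dot-· : ∀ {n} c (f v : Vecℚ n) → dot (c · f) v ≡ c * dot f v
dot-· c f v = trans (∑-cong (λ k → *-assoc c (f k) (v k))) (sym (*-distribˡ-∑ c (λ k → f k * v k)))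

dot-δ : ∀ {n} (i : Fin n) (v : Vecℚ n) → dot (δ i) v ≡ v i
dot-δ {suc n} zero v = begin
  1ℚ * v zero + ∑ (λ k → 0ℚ * v (suc k))  ≡⟨ cong (1ℚ * v zero +_) (∑-cong (λ k → *-zeroˡ (v (suc k)))) ⟩
  1ℚ * v zero + ∑ {n} (λ _ → 0ℚ)          ≡⟨ cong (1ℚ * v zero +_) (∑-zero n) ⟩
  1ℚ * v zero + 0ℚ                        ≡⟨ +-identityʳ (1ℚ * v zero) ⟩
  1ℚ * v zero                             ≡⟨ *-identityˡ (v zero) ⟩
  v zero                                  ∎
dot-δ {suc n} (suc i) v = begin
  0ℚ * v zero + dot (δ i) (v ∘ suc)  ≡⟨ cong (_+ dot (δ i) (v ∘ suc)) (*-zeroˡ (v zero)) ⟩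
  0ℚ + dot (δ i) (v ∘ suc)           ≡⟨ +-identityˡ (dot (δ i) (v ∘ suc)) ⟩
  dot (δ i) (v ∘ suc)                ≡⟨ dot-δ i (v ∘ suc) ⟩
  v (suc i)                          ∎

dot-apply : ∀ {n} (f : Vecℚ n) (A : Mat n) (v : Vecℚ n) → dot f (apply A v) ≡ dot (f ⊙ A) v
dot-apply f A v = begin
  ∑ (λ i → f i * ∑ (λ j → A i j * v j))    ≡⟨ ∑-cong (λ i → *-distribˡ-∑ (f i) (λ j → A i j * v j)) ⟩
  ∑ (λ i → ∑ (λ j → f i * (A i j * v j)))  ≡⟨ ∑-comm (λ i j → f i * (A i j * v j)) ⟩
  ∑ (λ j → ∑ (λ i → f i * (A i j * v j)))  ≡⟨ ∑-cong (λ j → ∑-cong (λ i → sym (*-assoc (f i) (A i j) (v j)))) ⟩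
  ∑ (λ j → ∑ (λ i → f i * A i j * v j))    ≡⟨ ∑-cong (λ j → sym (*-distribʳ-∑ (v j) (λ i → f i * A i j))) ⟩
  ∑ (λ j → (f ⊙ A) j * v j)                ∎

apply-apply-inverse : ∀ {n} (A B : Mat n) → (∀ i j → mul A B i j ≡ δ i j) →
                      ∀ v → apply A (apply B v) ≗ v
apply-apply-inverse A B AB≡I v i = begin
  apply A (apply B v) i  ≡⟨ dot-apply (A i) B v ⟩
  dot (mul A B i) v      ≡⟨ dot-congˡ v (AB≡I i) ⟩
  dot (δ i) v            ≡⟨ dot-δ i v ⟩
  v i                    ∎

Image-Ker : ∀ {n} {A B : Mat n} → IsInverse A B → ∀ f → SameSet (Image A (Ker f)) (Ker (f ⊙ B))
Image-Ker {A = A} {B} (AB≡I , BA≡I) f w = mk⇔ to from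
  where
  to : Image A (Ker f) w → Ker (f ⊙ B) w
  to (v , fv≡0 , Av≗w) = begin
    dot (f ⊙ B) w                ≡⟨ dot-congʳ (f ⊙ B) (sym ∘ Av≗w) ⟩
    dot (f ⊙ B) (apply A v)      ≡⟨ sym (dot-apply f B (apply A v)) ⟩
    dot f (apply B (apply A v))  ≡⟨ dot-congʳ f (apply-apply-inverse B A BA≡I v) ⟩
    dot f v                      ≡⟨ fv≡0 ⟩
    0ℚ                           ∎

  from : Ker (f ⊙ B) w → Image A (Ker f) w
  from fBw≡0 = apply B w , trans (dot-apply f B w) fBw≡0 , apply-apply-inverse A B AB≡I w

infix 4 _∝⟨_⟩_ _∝⟨_⟩?_

_∝⟨_⟩_ : ∀ {n} → Vecℚ n → ℚ → Vecℚ n → Set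
f ∝⟨ c ⟩ g = c ≢ 0ℚ × g ≗ c · f

Ker-∝ : ∀ {n} {f g : Vecℚ n} {c} → f ∝⟨ c ⟩ g → SameSet (Ker f) (Ker g)
Ker-∝ {f = f} {g} {c} (c≢0 , g≗cf) w = mk⇔ to from
  where
  instance _ = ≢-nonZero c≢0

  dot-g : dot g w ≡ c * dot f w
  dot-g = trans (dot-congˡ w g≗cf) (dot-· c f w)

  to : Ker f w → Ker g w
  to fw≡0 = trans dot-g (trans (cong (c *_) fw≡0) (*-zeroʳ c))

  from : Ker g w → Ker f w
  from gw≡0 = begin
    dot f w                 ≡⟨ sym (*-identityˡ _) ⟩
    1ℚ * dot f w            ≡⟨ cong (_* dot f w) (sym (*-inverseˡ c)) ⟩
    1/ c * c * dot f w      ≡⟨ *-assoc (1/ c) c (dot f w) ⟩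
    1/ c * (c * dot f w)    ≡⟨ cong (1/ c *_) (trans (sym dot-g) gw≡0) ⟩
    1/ c * 0ℚ               ≡⟨ *-zeroʳ (1/ c) ⟩
    0ℚ                      ∎

infix 4 _≟ᵥ_ _≟ₘ_

_≟ᵥ_ : ∀ {n} (f g : Vecℚ n) → Dec (f ≗ g)
f ≟ᵥ g = all? λ k → f k ≟ g k

_≟ₘ_ : ∀ {n} (A B : Mat n) → Dec (∀ i j → A i j ≡ B i j)
A ≟ₘ B = all? λ i → A i ≟ᵥ B i

_∝⟨_⟩?_ : ∀ {n} (f : Vecℚ n) c g → Dec (f ∝⟨ c ⟩ g)
f ∝⟨ c ⟩? g = ¬? (c ≟ 0ℚ) ×-dec (g ≟ᵥ c · f)

allSubsets? : ∀ {n} {P : Subset n → Set} → Decidable P → Dec (∀ I → P I)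
allSubsets? P? = map′ (λ ¬∃¬P I → decidable-stable (P? I) (λ ¬PI → ¬∃¬P (I , ¬PI)))
                      (λ ∀P (I , ¬PI) → ¬PI (∀P I))
                      (¬? (anySubset? (¬? ∘ P?)))

φ⁻¹ : Mat 4
φ⁻¹ i j = lookup (lookup rows i) j
  where
  rows : Vec (Vec ℚ 4) 4
  rows = (1ℚ ∷   1ℚ ∷ 0ℚ ∷   0ℚ ∷ [])
       ∷ (1ℚ ∷ - 1ℚ ∷ 0ℚ ∷   0ℚ ∷ [])
       ∷ (0ℚ ∷   0ℚ ∷ 1ℚ ∷   1ℚ ∷ [])
       ∷ (0ℚ ∷   0ℚ ∷ 1ℚ ∷ - 1ℚ ∷ [])
       ∷ []

φ : Mat 4
φ i j = ½ * φ⁻¹ i j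

φ-inverse : IsInverse φ φ⁻¹
φ-inverse = toWitness {a? = mul φ φ⁻¹ ≟ₘ δ} _ , toWitness {a? = mul φ⁻¹ φ ≟ₘ δ} _

pair₀₁ pair₂₃ : Bool → Fin 4
pair₀₁ false = 0F
pair₀₁ true  = 1F
pair₂₃ false = 2F
pair₂₃ true  = 3F

pair₀₁<pair₂₃ : ∀ b c → pair₀₁ b < pair₂₃ c
pair₀₁<pair₂₃ false false = s≤s z≤n
pair₀₁<pair₂₃ false true  = s≤s z≤n
pair₀₁<pair₂₃ true  false = s≤s (s≤s z≤n)
pair₀₁<pair₂₃ true  true  = s≤s (s≤s z≤n)

-- With s the ±1 sign vector of I, hI I ⊙ φ⁻¹ = 2 s₀ (x_i + s₀ s₂ x_j),
-- where i = 0 iff s₀ = s₁ and j = 2 iff s₂ = s₃.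
crossRoot : Subset 4 → DIndex 4
crossRoot (s₀ ∷ s₁ ∷ s₂ ∷ s₃ ∷ []) =
  ((pair₀₁ (s₀ xor s₁) , pair₂₃ (s₂ xor s₃)) , pair₀₁<pair₂₃ _ _) , not (s₀ xor s₂)

crossScale : Subset 4 → ℚ
crossScale (true  ∷ _) = ½
crossScale (false ∷ _) = -½

matchingRoot : HIndex 4 → DIndex 4
matchingRoot (inj₁ 0F)      = ((0F , 1F) , s≤s z≤n) , true
matchingRoot (inj₁ 1F)      = ((0F , 1F) , s≤s z≤n) , false
matchingRoot (inj₁ 2F)      = ((2F , 3F) , s≤s (s≤s (s≤s z≤n))) , true
matchingRoot (inj₁ 3F)      = ((2F , 3F) , s≤s (s≤s (s≤s z≤n))) , false
matchingRoot (inj₂ (I , _)) = crossRoot I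

matchingScale : HIndex 4 → ℚ
matchingScale (inj₁ _)       = 1ℚ
matchingScale (inj₂ (I , _)) = crossScale I

matchingRoot-∝ : ∀ a → hFun a ⊙ φ⁻¹ ∝⟨ matchingScale a ⟩ dFun (matchingRoot a)
matchingRoot-∝ (inj₁ k) =
  toWitness {a? = all? λ i → hFun (inj₁ i) ⊙ φ⁻¹ ∝⟨ 1ℚ ⟩? dFun (matchingRoot (inj₁ i))} _ k
matchingRoot-∝ (inj₂ (I , _)) =
  toWitness {a? = allSubsets? λ J → hI J ⊙ φ⁻¹ ∝⟨ crossScale J ⟩? dFun (crossRoot J)} _ I

image-hyperplane : ∀ a → SameSet (Image φ (Ker (hFun a))) (Ker (dFun (matchingRoot a)))
image-hyperplane a w =
  ⇔-trans (Image-Ker {A = φ} {φ⁻¹} φ-inverse (hFun a) w) (Ker-∝ (matchingRoot-∝ a) w)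

-- dFun ignores the proof of i < j, so hitBy a also serves every b with the same i, j and sign.
hitBy : ∀ a → ∃ λ a′ → SameSet (Image φ (Ker (hFun a′))) (Ker (dFun (matchingRoot a)))
hitBy a = a , image-hyperplane a

matchingHyperplane : ∀ b → ∃ λ a → SameSet (Image φ (Ker (hFun a))) (Ker (dFun b))
matchingHyperplane (((0F , 1F) , _) , true)  = hitBy (inj₁ 0F)
matchingHyperplane (((0F , 1F) , _) , false) = hitBy (inj₁ 1F)
matchingHyperplane (((2F , 3F) , _) , true)  = hitBy (inj₁ 2F)
matchingHyperplane (((2F , 3F) , _) , false) = hitBy (inj₁ 3F)
matchingHyperplane (((0F , 2F) , _) , true)  = hitBy (inj₂ (true ∷ true  ∷ true  ∷ true  ∷ [] , 0F , here))
matchingHyperplane (((0F , 2F) , _) , false) = hitBy (inj₂ (true ∷ true  ∷ false ∷ false ∷ [] , 0F , here))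
matchingHyperplane (((0F , 3F) , _) , true)  = hitBy (inj₂ (true ∷ true  ∷ true  ∷ false ∷ [] , 0F , here))
matchingHyperplane (((0F , 3F) , _) , false) = hitBy (inj₂ (true ∷ true  ∷ false ∷ true  ∷ [] , 0F , here))
matchingHyperplane (((1F , 2F) , _) , true)  = hitBy (inj₂ (true ∷ false ∷ true  ∷ true  ∷ [] , 0F , here))
matchingHyperplane (((1F , 2F) , _) , false) = hitBy (inj₂ (true ∷ false ∷ false ∷ false ∷ [] , 0F , here))
matchingHyperplane (((1F , 3F) , _) , true)  = hitBy (inj₂ (true ∷ false ∷ true  ∷ false ∷ [] , 0F , here))
matchingHyperplane (((1F , 3F) , _) , false) = hitBy (inj₂ (true ∷ false ∷ false ∷ true  ∷ [] , 0F , here))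
matchingHyperplane (((_ , 0F) , ()) , _)
matchingHyperplane (((suc _ , 1F) , s≤s ()) , _)
matchingHyperplane (((suc (suc _) , 2F) , s≤s (s≤s ())) , _)
matchingHyperplane (((3F , 3F) , s≤s (s≤s (s≤s ()))) , _)

lemma3p2 : Σ (Mat 4) λ M → Σ (Mat 4) λ N → IsInverse M N
    × (∀ (a : HIndex 4) → ∃ λ (b : DIndex 4) → SameSet (Image M (Ker (hFun a))) (Ker (dFun b)))
    × (∀ (b : DIndex 4) → ∃ λ (a : HIndex 4) → SameSet (Image M (Ker (hFun a))) (Ker (dFun b)))
lemma3p2 = φ , φ⁻¹ , φ-inverse , (λ a → matchingRoot a , image-hyperplane a) , matchingHyperplane
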